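{- Let $\Pi$ be a 3-polygraph, $\alpha$ a $3$-cell of $\Pi$ and $F$ an elementary $3$-path containing only the $3$-cell $\alpha$. Assume $\Pi$ is equipped with a polygraphic interpretation $(\phi,\partial)$ such that $\phi$ is compatible with and conservative on $\alpha$. Then for every $x\in\phi(s_1F)$, in $\mathbb{Z}$: $$\partial(t_2F)(x)-\partial(s_2F)(x)\le\sum_{c\in\Pi_2}\|t_2(\alpha)\|_c\cdot\partial c\big(\partial_\phi(s_2F)(x),\dots,\partial_\phi(s_2F)(x)\big).$$
   Context: A 3-polygraph $\Pi$ has sets $\Pi_k$ of $k$-cells and freely generates a strict $3$-category whose $k$-morphisms are $k$-paths, composed by $\star_j$ ($0\le j<k$); $s_j,t_j$ are $j$-source/target. For a $2$-path $f$ and a $2$-cell $c$, $\|f\|_c$ is the number of occurrences of $c$ in $f$. An elementary $3$-path is one containing exactly one $3$-cell; it has the form $f\star_1(u\star_0\alpha\star_0v)\star_1g$. A functorial interpretation $\phi$ assigns to each $1$-path $u$ with $n$ $1$-cells a nonempty $\phi(u)\subseteq(\mathbb{N}\setminus\{0\})^n$ and to each $2$-path $f:u\Rightarrow v$ a monotone map $\phi(f):\phi(u)\to\phi(v)$ (product order), with $\phi(u\star_0v)=\phi(u)\times\phi(v)$, $\phi(f\star_0g)=\phi(f)\times\phi(g)$, $\phi(f\star_1g)=\phi(g)\circ\phi(f)$, identities to identities; compatible with $\alpha$ if $\phi(s_2\alpha)\ge\phi(t_2\alpha)$ pointwise. A polygraphic interpretation is a pair $(\phi,\partial)$ with $\partial$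 assigning to each $2$-path $f$ with $1$-source $u$ a monotone map $\partial f:\phi(u)\to\mathbb{N}$ with $\partial(\text{identity})=0$, $\partial(f\star_0g)(x,y)=\partial f(x)+\partial g(y)$, $\partial(f\star_1g)=\partial f+\partial g\circ\phi(f)$. $\partial_\phi$ is the analogous map into $(\mathbb{N},\max,0)$ (with $\max$ replacing $+$) determined by $\partial_\phi c(x_1,\dots,x_m)=\max\{x_1,\dots,x_m,y_1,\dots,y_n\}$, $(y_1,\dots,y_n)=\phi(c)(x)$, for each $2$-cell $c$; $\phi$ is conservative on $\alpha$ if $\partial_\phi(s_2\alpha)\ge\partial_\phi(t_2\alpha)$ pointwise. Convention: when $\partial c$ (domain $\phi(s_1c)$) is applied to a tuple $z$ not in its domain, it means $\partial c(y)$ where $y$ is the maximum element of $\phi(s_1c)$ below $z$. -}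

module Defs where

open import Data.Nat using (ℕ; zero; suc; _+_; _≤_; _⊔_)
open import Data.Product using (Σ; _×_; _,_; proj₁; proj₂; ∃)
open import Data.List using (List; []; _∷_; _++_)
open import Data.List.Relation.Unary.All using (All; []; _∷_)
open import Data.Unit using (⊤; tt)

data Path1 {V E : Set} (s t : E → V) : V → V → Set where
  ε1  : ∀ {x} → Path1 s t x x
  _◂_ : ∀ {y} (e : E) → Path1 s t (t e) y → Path1 s t (s e) y

infixr 5 _◂_ _++₁_

_++₁_ : ∀ {V E} {s t : E → V} {x y z} → Path1 s t x y → Path1 s t y z → Path1 s t x z
ε1 ++₁ v = v
(e ◂ u) ++₁ v = e ◂ (u ++₁ v)

-- Tuples of naturals indexed by a 1-path (one entry per 1-cell):
-- the ambient set N^n containing phi(u).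

data Elt {V E : Set} {s t : E → V} : ∀ {x y} → Path1 s t x y → Set where
  []  : ∀ {x} → Elt (ε1 {x = x})
  _∷_ : ∀ {y} {e : E} {u : Path1 s t (t e) y} → ℕ → Elt u → Elt (e ◂ u)

module _ {V E : Set} {s t : E → V} where

  splitE : ∀ {x y z} (u : Path1 s t x y) {v : Path1 s t y z} → Elt (u ++₁ v) → Elt u × Elt v
  splitE ε1 xs = [] , xs
  splitE (e ◂ u) (n ∷ xs) = let (a , b) = splitE u xs in (n ∷ a) , b

  _++E_ : ∀ {x y z} {u : Path1 s t x y} {v : Path1 s t y z} → Elt u → Elt v → Elt (u ++₁ v)
  [] ++E ys = ys
  (n ∷ xs) ++E ys = n ∷ (xs ++E ys)

  _≤*_ : ∀ {x y} {u : Path1 s t x y} → Elt u → Elt u → Set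
  [] ≤* [] = ⊤
  (m ∷ xs) ≤* (n ∷ ys) = (m ≤ n) × (xs ≤* ys)

  InPhi : (E → ℕ → Set) → ∀ {x y} {u : Path1 s t x y} → Elt u → Set
  InPhi Φ [] = ⊤
  InPhi Φ (_∷_ {e = e} n xs) = Φ e n × InPhi Φ xs

  constE : ℕ → ∀ {x y} (u : Path1 s t x y) → Elt u
  constE m ε1 = []
  constE m (e ◂ u) = m ∷ constE m u

  maxE : ∀ {x y} {u : Path1 s t x y} → Elt u → ℕ
  maxE [] = 0
  maxE (n ∷ xs) = n ⊔ maxE xs

record Poly2 : Set₁ where
  field
    Π0 Π1 : Set
    s0 t0 : Π1 → Π0
    Π2 : Set
    s0₂ t0₂ : Π2 → Π0
    s1 t1 : (c : Π2) → Path1 s0 t0 (s0₂ c) (t0₂ c)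

module _ (P : Poly2) where
  open Poly2 P

  -- 2-paths of the free 2-category, given by (representative) terms built
  -- from 2-cells, identities, ⋆₀ and ⋆₁.  All quantities below are invariant
  -- under the 2-category axioms, so this represents 2-paths faithfully.
  infixr 6 _⋆₀_
  infixr 4 _⋆₁_
  data Path2 : ∀ {x y} → Path1 s0 t0 x y → Path1 s0 t0 x y → Set where
    cell : (c : Π2) → Path2 (s1 c) (t1 c)
    id2  : ∀ {x y} (u : Path1 s0 t0 x y) → Path2 u u
    _⋆₀_ : ∀ {x y z} {u v : Path1 s0 t0 x y} {u' v' : Path1 s0 t0 y z} →
           Path2 u v → Path2 u' v' → Path2 (u ++₁ u') (v ++₁ v')
    _⋆₁_ : ∀ {x y} {u v w : Path1 s0 t0 x y} → Path2 u v → Path2 v w → Path2 u w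

  -- list of occurrences of 2-cells in a 2-path (‖f‖_c = multiplicity of c)
  cells : ∀ {x y} {u v : Path1 s0 t0 x y} → Path2 u v → List Π2
  cells (cell c) = c ∷ []
  cells (id2 u) = []
  cells (f ⋆₀ g) = cells f ++ cells g
  cells (f ⋆₁ g) = cells f ++ cells g

record Poly3 : Set₁ where
  field
    P2 : Poly2
  open Poly2 P2
  field
    Π3 : Set
    s0₃ t0₃ : Π3 → Π0
    s1₃ t1₃ : (α : Π3) → Path1 s0 t0 (s0₃ α) (t0₃ α)
    s2 t2 : (α : Π3) → Path2 P2 (s1₃ α) (t1₃ α)

-- An elementary 3-path  F = f ⋆₁ (a ⋆₀ α ⋆₀ b) ⋆₁ g  containing only α.
record Elementary (P : Poly3) (α : Poly3.Π3 P) : Set where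
  open Poly3 P
  open Poly2 P2
  field
    x y : Π0
    a : Path1 s0 t0 x (s0₃ α)
    b : Path1 s0 t0 (t0₃ α) y
    u w : Path1 s0 t0 x y
    f : Path2 P2 u ((a ++₁ s1₃ α) ++₁ b)
    g : Path2 P2 ((a ++₁ t1₃ α) ++₁ b) w
  s2F : Path2 P2 u w
  s2F = f ⋆₁ (((id2 a) ⋆₀ s2 α) ⋆₀ id2 b) ⋆₁ g
  t2F : Path2 P2 u w
  t2F = f ⋆₁ (((id2 a) ⋆₀ t2 α) ⋆₀ id2 b) ⋆₁ g

module _ (P : Poly2) where
  open Poly2 P

  private
    Tup : ∀ {x y} → Path1 s0 t0 x y → Set
    Tup = Elt

  -- Maps φ(c) are given as functions on
  -- all tuples, only their restriction to φ(s₁c) is relevant.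
  record FunInterp : Set₁ where
    field
      Φ1      : Π1 → ℕ → Set
      Φ1-pos  : ∀ a n → Φ1 a n → 1 ≤ n
      Φ1-ne   : ∀ a → ∃ (Φ1 a)
      φc      : (c : Π2) → Tup (s1 c) → Tup (t1 c)
      φc-mem  : ∀ c (z : Tup (s1 c)) → InPhi Φ1 z → InPhi Φ1 (φc c z)
      φc-mono : ∀ c (z z' : Tup (s1 c)) → InPhi Φ1 z → InPhi Φ1 z' →
                z ≤* z' → φc c z ≤* φc c z'

    φ₂ : ∀ {x y} {u v : Path1 s0 t0 x y} → Path2 P u v → Tup u → Tup v
    φ₂ (cell c) z = φc c z
    φ₂ (id2 u) z = z
    φ₂ (_⋆₀_ {u = u} f g) z = let (z1 , z2) = splitE u z in φ₂ f z1 ++E φ₂ g z2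
    φ₂ (f ⋆₁ g) z = φ₂ g (φ₂ f z)

    ∂φ₂ : ∀ {x y} {u v : Path1 s0 t0 x y} → Path2 P u v → Tup u → ℕ
    ∂φ₂ (cell c) z = maxE z ⊔ maxE (φc c z)
    ∂φ₂ (id2 u) z = 0
    ∂φ₂ (_⋆₀_ {u = u} f g) z = let (z1 , z2) = splitE u z in ∂φ₂ f z1 ⊔ ∂φ₂ g z2
    ∂φ₂ (f ⋆₁ g) z = ∂φ₂ f z ⊔ ∂φ₂ g (φ₂ f z)

  record PolyInterp : Set₁ where
    field
      fi      : FunInterp
    open FunInterp fi public
    field
      ∂c      : (c : Π2) → Tup (s1 c) → ℕ
      ∂c-mono : ∀ c (z z' : Tup (s1 c)) → InPhi Φ1 z → InPhi Φ1 z' →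
                z ≤* z' → ∂c c z ≤ ∂c c z'

    ∂₂ : ∀ {x y} {u v : Path1 s0 t0 x y} → Path2 P u v → Tup u → ℕ
    ∂₂ (cell c) z = ∂c c z
    ∂₂ (id2 u) z = 0
    ∂₂ (_⋆₀_ {u = u} f g) z = let (z1 , z2) = splitE u z in ∂₂ f z1 + ∂₂ g z2
    ∂₂ (f ⋆₁ g) z = ∂₂ f z + ∂₂ g (φ₂ f z)

    IsMaxBelow : (c : Π2) → Tup (s1 c) → Tup (s1 c) → Set
    IsMaxBelow c z y = InPhi Φ1 y × (y ≤* z) ×
                       (∀ y' → InPhi Φ1 y' → y' ≤* z → y' ≤* y)

    sumMax : ∀ {z : (c : Π2) → Tup (s1 c)} {cs : List Π2} →
             All (λ c → Σ (Tup (s1 c)) (IsMaxBelow c (z c))) cs → ℕ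
    sumMax [] = 0
    sumMax (_∷_ {x = c} (y , _) ys) = ∂c c y + sumMax ys

module _ (P : Poly3) where
  open Poly3 P
  open Poly2 P2

  Compatible : FunInterp P2 → Π3 → Set
  Compatible I α = ∀ z → InPhi Φ1 z → φ₂ (t2 α) z ≤* φ₂ (s2 α) z
    where open FunInterp I

  Conservative : FunInterp P2 → Π3 → Set
  Conservative I α = ∀ z → InPhi Φ1 z → ∂φ₂ (t2 α) z ≤ ∂φ₂ (s2 α) z
    where open FunInterp I

{-# OPTIONS --safe #-}
-- Write s₂F = f ⋆₁ (a ⋆₀ s₂α ⋆₀ b) ⋆₁ g and t₂F likewise, and let m = ∂_φ(s₂F)(x).
-- Both sides share the cost of f; by compatibility the point at which g is evaluated
-- decreases when s₂α is replaced by t₂α, so by monotonicity g costs no more.  What remains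
-- is the cost of t₂α at the point z reached by f: conservativity gives
-- ∂_φ(t₂α)(z) ≤ ∂_φ(s₂α)(z) ≤ m, and as ∂_φ dominates every coordinate met during the
-- evaluation, each occurrence of a 2-cell c in t₂α costs at most ∂c(m, …, m).
module Submission where

open import Defs
open import Data.Nat using (ℕ)
open import Data.Integer using (+_; _-_; _≤_)
open import Data.Product using (Σ)
open import Data.List.Relation.Unary.All using (All)

open import Data.Nat as ℕ using (_+_; z≤n)
import Data.Nat.Properties as ℕ
import Data.Integer as ℤ
import Data.Integer.Properties as ℤ
open import Data.Product using (_,_; _×_; proj₁; proj₂)
open import Data.List using (List; []; _∷_; _++_)
open import Data.List.Relation.Unary.All using ([]; _∷_)
open import Data.List.Relation.Unary.All.Properties using (++⁻ˡ; ++⁻ʳ)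
open import Data.Unit using (tt)
open import Relation.Binary.PropositionalEquality using (_≡_; refl; sym; trans; cong; subst)
open import Data.Nat.Tactic.RingSolver using (solve-∀)

[+m]-[+n]≤+o : ∀ m n o → m ℕ.≤ n + o → + m - + n ≤ + o
[+m]-[+n]≤+o m n o m≤n+o = begin
  + m - + n        ≡⟨ ℤ.[+m]-[+n]≡m⊖n m n ⟩
  m ℤ.⊖ n          ≤⟨ ℤ.⊖-monoˡ-≤ n m≤n+o ⟩
  (n + o) ℤ.⊖ n    ≡⟨ ℤ.⊖-≥ (ℕ.m≤m+n n o) ⟩
  + (n + o ℕ.∸ n)  ≡⟨ cong +_ (ℕ.m+n∸m≡n n o) ⟩
  + o              ∎
  where open ℤ.≤-Reasoning

+-move-right : ∀ a b c d → a + ((b + c) + d) ≡ (a + (b + d)) + c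
+-move-right = solve-∀

module _ {V E : Set} {s t : E → V} where

  middle : ∀ {w x y z} (a : Path1 s t w x) (v : Path1 s t x y) {b : Path1 s t y z} →
           Elt ((a ++₁ v) ++₁ b) → Elt v
  middle a v z = proj₂ (splitE a (proj₁ (splitE (a ++₁ v) z)))

  ≤*-refl : ∀ {x y} {u : Path1 s t x y} (a : Elt u) → a ≤* a
  ≤*-refl []      = tt
  ≤*-refl (n ∷ a) = ℕ.≤-refl , ≤*-refl a

  ++E-mono-≤* : ∀ {x y z} {u : Path1 s t x y} {v : Path1 s t y z} {a a′ : Elt u} {b b′ : Elt v} →
                a ≤* a′ → b ≤* b′ → (a ++E b) ≤* (a′ ++E b′)
  ++E-mono-≤* {a = []}    {[]}     _            b≤b′ = b≤b′
  ++E-mono-≤* {a = _ ∷ _} {_ ∷ _} (m≤n , a≤a′) b≤b′ = m≤n , ++E-mono-≤* a≤a′ b≤b′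

  splitE-mono-≤* : ∀ {x y z} (u : Path1 s t x y) {v : Path1 s t y z} {w w′ : Elt (u ++₁ v)} → w ≤* w′ →
                   (proj₁ (splitE u w) ≤* proj₁ (splitE u w′)) × (proj₂ (splitE u w) ≤* proj₂ (splitE u w′))
  splitE-mono-≤* ε1      w≤w′ = tt , w≤w′
  splitE-mono-≤* (e ◂ u) {w = _ ∷ _} {_ ∷ _} (m≤n , w≤w′) =
    let (l , r) = splitE-mono-≤* u w≤w′ in (m≤n , l) , r

  ≤*-constE : ∀ {x y} {u : Path1 s t x y} {m} (a : Elt u) → maxE a ℕ.≤ m → a ≤* constE m u
  ≤*-constE []      _  = tt
  ≤*-constE (n ∷ a) ≤m = ℕ.m⊔n≤o⇒m≤o n _ ≤m , ≤*-constE a (ℕ.m⊔n≤o⇒n≤o n _ ≤m)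

  module _ (Φ : E → ℕ → Set) where

    InPhi-splitE : ∀ {x y z} (u : Path1 s t x y) {v : Path1 s t y z} {w : Elt (u ++₁ v)} → InPhi Φ w →
                   InPhi Φ (proj₁ (splitE u w)) × InPhi Φ (proj₂ (splitE u w))
    InPhi-splitE ε1      w∈Φ = tt , w∈Φ
    InPhi-splitE (e ◂ u) {w = _ ∷ _} (n∈Φ , w∈Φ) =
      let (l , r) = InPhi-splitE u w∈Φ in (n∈Φ , l) , r

    InPhi-++E : ∀ {x y z} {u : Path1 s t x y} {v : Path1 s t y z} {a : Elt u} {b : Elt v} →
                InPhi Φ a → InPhi Φ b → InPhi Φ (a ++E b)
    InPhi-++E {a = []}    _           b∈Φ = b∈Φ
    InPhi-++E {a = _ ∷ _} (n∈Φ , a∈Φ) b∈Φ = n∈Φ , InPhi-++E a∈Φ b∈Φ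

    InPhi-middle : ∀ {w x y z} (a : Path1 s t w x) (v : Path1 s t x y) {b : Path1 s t y z}
                   {c : Elt ((a ++₁ v) ++₁ b)} → InPhi Φ c → InPhi Φ (middle a v c)
    InPhi-middle a v c∈Φ = proj₂ (InPhi-splitE a (proj₁ (InPhi-splitE (a ++₁ v) c∈Φ)))

module _ {P : Poly2} where
  open Poly2 P

  whisker : ∀ {w x y z} (a : Path1 s0 t0 w x) {v v′ : Path1 s0 t0 x y} → Path2 P v v′ →
            (b : Path1 s0 t0 y z) → Path2 P ((a ++₁ v) ++₁ b) ((a ++₁ v′) ++₁ b)
  whisker a h b = (id2 a ⋆₀ h) ⋆₀ id2 b

module Interp {P : Poly2} (I : PolyInterp P) where
  open Poly2 P
  open PolyInterp I

  φ₂-InPhi : ∀ {x y} {u v : Path1 s0 t0 x y} (h : Path2 P u v) {z} → InPhi Φ1 z → InPhi Φ1 (φ₂ h z)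
  φ₂-InPhi (cell c)           z∈φ = φc-mem c _ z∈φ
  φ₂-InPhi (id2 u)            z∈φ = z∈φ
  φ₂-InPhi (_⋆₀_ {u = u} f g) z∈φ =
    let (z₁∈φ , z₂∈φ) = InPhi-splitE Φ1 u z∈φ in InPhi-++E Φ1 (φ₂-InPhi f z₁∈φ) (φ₂-InPhi g z₂∈φ)
  φ₂-InPhi (f ⋆₁ g)           z∈φ = φ₂-InPhi g (φ₂-InPhi f z∈φ)

  φ₂-mono : ∀ {x y} {u v : Path1 s0 t0 x y} (h : Path2 P u v) {z z′} → InPhi Φ1 z → InPhi Φ1 z′ →
            z ≤* z′ → φ₂ h z ≤* φ₂ h z′
  φ₂-mono (cell c)           z∈φ z′∈φ z≤z′ = φc-mono c _ _ z∈φ z′∈φ z≤z′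
  φ₂-mono (id2 u)            z∈φ z′∈φ z≤z′ = z≤z′
  φ₂-mono (_⋆₀_ {u = u} f g) z∈φ z′∈φ z≤z′ =
    let (z₁∈φ , z₂∈φ) = InPhi-splitE Φ1 u z∈φ
        (z₁′∈φ , z₂′∈φ) = InPhi-splitE Φ1 u z′∈φ
        (z₁≤z₁′ , z₂≤z₂′) = splitE-mono-≤* u z≤z′
    in ++E-mono-≤* (φ₂-mono f z₁∈φ z₁′∈φ z₁≤z₁′) (φ₂-mono g z₂∈φ z₂′∈φ z₂≤z₂′)
  φ₂-mono (f ⋆₁ g)           z∈φ z′∈φ z≤z′ =
    φ₂-mono g (φ₂-InPhi f z∈φ) (φ₂-InPhi f z′∈φ) (φ₂-mono f z∈φ z′∈φ z≤z′)

  ∂₂-mono : ∀ {x y} {u v : Path1 s0 t0 x y} (h : Path2 P u v) {z z′} → InPhi Φ1 z → InPhi Φ1 z′ →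
            z ≤* z′ → ∂₂ h z ℕ.≤ ∂₂ h z′
  ∂₂-mono (cell c)           z∈φ z′∈φ z≤z′ = ∂c-mono c _ _ z∈φ z′∈φ z≤z′
  ∂₂-mono (id2 u)            z∈φ z′∈φ z≤z′ = z≤n
  ∂₂-mono (_⋆₀_ {u = u} f g) z∈φ z′∈φ z≤z′ =
    let (z₁∈φ , z₂∈φ) = InPhi-splitE Φ1 u z∈φ
        (z₁′∈φ , z₂′∈φ) = InPhi-splitE Φ1 u z′∈φ
        (z₁≤z₁′ , z₂≤z₂′) = splitE-mono-≤* u z≤z′
    in ℕ.+-mono-≤ (∂₂-mono f z₁∈φ z₁′∈φ z₁≤z₁′) (∂₂-mono g z₂∈φ z₂′∈φ z₂≤z₂′)
  ∂₂-mono (f ⋆₁ g)           z∈φ z′∈φ z≤z′ =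
    ℕ.+-mono-≤ (∂₂-mono f z∈φ z′∈φ z≤z′)
               (∂₂-mono g (φ₂-InPhi f z∈φ) (φ₂-InPhi f z′∈φ) (φ₂-mono f z∈φ z′∈φ z≤z′))

  MaxBelow : ((c : Π2) → Elt (s1 c)) → Π2 → Set
  MaxBelow z c = Σ (Elt (s1 c)) (IsMaxBelow c (z c))

  sumMax-++ : ∀ {z} (cs : List Π2) {ds} (ys : All (MaxBelow z) (cs ++ ds)) →
              sumMax ys ≡ sumMax (++⁻ˡ cs ys) + sumMax (++⁻ʳ cs ys)
  sumMax-++ []       ys = refl
  sumMax-++ (c ∷ cs) ((y , _) ∷ ys) =
    trans (cong (∂c c y ℕ.+_) (sumMax-++ cs ys)) (sym (ℕ.+-assoc (∂c c y) _ _))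

  -- ∂_φ h z bounds every entry of every tuple met while evaluating h at z, so each
  -- occurrence of a 2-cell c in h is evaluated below (m, …, m).
  ∂₂≤sumMax : ∀ {x y} {u v : Path1 s0 t0 x y} (h : Path2 P u v) {z m} → InPhi Φ1 z → ∂φ₂ h z ℕ.≤ m →
              (ys : All (MaxBelow (λ c → constE m (s1 c))) (cells P h)) → ∂₂ h z ℕ.≤ sumMax ys
  ∂₂≤sumMax (cell c) {z} z∈φ ∂φ≤m ((y , y∈φ , _ , maximal) ∷ []) = begin
    ∂c c z      ≤⟨ ∂c-mono c z y z∈φ y∈φ (maximal z z∈φ (≤*-constE z (ℕ.m⊔n≤o⇒m≤o _ _ ∂φ≤m))) ⟩
    ∂c c y      ≤⟨ ℕ.m≤m+n _ 0 ⟩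
    ∂c c y + 0  ∎
    where open ℕ.≤-Reasoning
  ∂₂≤sumMax (id2 u) z∈φ ∂φ≤m ys = z≤n
  ∂₂≤sumMax (_⋆₀_ {u = u} f g) z∈φ ∂φ≤m ys =
    let (z₁∈φ , z₂∈φ) = InPhi-splitE Φ1 u z∈φ in
    subst (_ ℕ.≤_) (sym (sumMax-++ (cells P f) ys))
      (ℕ.+-mono-≤ (∂₂≤sumMax f z₁∈φ (ℕ.m⊔n≤o⇒m≤o _ _ ∂φ≤m) (++⁻ˡ _ ys))
                  (∂₂≤sumMax g z₂∈φ (ℕ.m⊔n≤o⇒n≤o _ _ ∂φ≤m) (++⁻ʳ _ ys)))
  ∂₂≤sumMax (f ⋆₁ g) z∈φ ∂φ≤m ys =
    subst (_ ℕ.≤_) (sym (sumMax-++ (cells P f) ys))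
      (ℕ.+-mono-≤ (∂₂≤sumMax f z∈φ (ℕ.m⊔n≤o⇒m≤o _ _ ∂φ≤m) (++⁻ˡ _ ys))
                  (∂₂≤sumMax g (φ₂-InPhi f z∈φ) (ℕ.m⊔n≤o⇒n≤o _ _ ∂φ≤m) (++⁻ʳ _ ys)))

  ∂₂-whisker : ∀ {w x y z} (a : Path1 s0 t0 w x) {v v′ : Path1 s0 t0 x y} (h : Path2 P v v′)
               (b : Path1 s0 t0 y z) (c : Elt ((a ++₁ v) ++₁ b)) →
               ∂₂ (whisker a h b) c ≡ ∂₂ h (middle a v c)
  ∂₂-whisker a h b c = ℕ.+-identityʳ _

  ∂φ₂-whisker : ∀ {w x y z} (a : Path1 s0 t0 w x) {v v′ : Path1 s0 t0 x y} (h : Path2 P v v′)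
                (b : Path1 s0 t0 y z) (c : Elt ((a ++₁ v) ++₁ b)) →
                ∂φ₂ (whisker a h b) c ≡ ∂φ₂ h (middle a v c)
  ∂φ₂-whisker a h b c = ℕ.⊔-identityʳ _

  φ₂-whisker-mono : ∀ {w x y z} (a : Path1 s0 t0 w x) {v v′ : Path1 s0 t0 x y} (h h′ : Path2 P v v′)
                    (b : Path1 s0 t0 y z) {c : Elt ((a ++₁ v) ++₁ b)} →
                    φ₂ h′ (middle a v c) ≤* φ₂ h (middle a v c) →
                    φ₂ (whisker a h′ b) c ≤* φ₂ (whisker a h b) c
  φ₂-whisker-mono a {v} h h′ b {c} le =
    let (c₁ , c₂) = splitE (a ++₁ v) c
    in ++E-mono-≤* (++E-mono-≤* (≤*-refl (proj₁ (splitE a c₁))) le) (≤*-refl c₂)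

  ∂φ₂-middle≤ : ∀ {x y} {u v w w′ : Path1 s0 t0 x y} (f : Path2 P u v) (h : Path2 P v w) (g : Path2 P w w′)
                (z : Elt u) → ∂φ₂ h (φ₂ f z) ℕ.≤ ∂φ₂ (f ⋆₁ h ⋆₁ g) z
  ∂φ₂-middle≤ f h g z = ℕ.≤-trans (ℕ.m≤m⊔n _ _) (ℕ.m≤n⊔m (∂φ₂ f z) _)

  ∂₂-replace-middle : ∀ {x y} {u v w w′ : Path1 s0 t0 x y} (f : Path2 P u v) (h h′ : Path2 P v w)
                      (g : Path2 P w w′) {z : Elt u} {m} → InPhi Φ1 z →
                      φ₂ h′ (φ₂ f z) ≤* φ₂ h (φ₂ f z) → ∂₂ h′ (φ₂ f z) ℕ.≤ ∂₂ h (φ₂ f z) + m →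
                      ∂₂ (f ⋆₁ h′ ⋆₁ g) z ℕ.≤ ∂₂ (f ⋆₁ h ⋆₁ g) z + m
  ∂₂-replace-middle {v = v} f h h′ g {z} {m} z∈φ φh′≤φh ∂h′≤ = begin
    F + (H′ + ∂₂ g (φ₂ h′ fz))  ≤⟨ ℕ.+-monoʳ-≤ F (ℕ.+-mono-≤ ∂h′≤ ∂g-mono) ⟩
    F + ((H + m) + G)           ≡⟨ +-move-right F H m G ⟩
    (F + (H + G)) + m           ∎
    where
    open ℕ.≤-Reasoning
    fz : Elt v
    fz = φ₂ f z
    F H H′ G : ℕ
    F = ∂₂ f z
    H = ∂₂ h fz
    H′ = ∂₂ h′ fz
    G = ∂₂ g (φ₂ h fz)
    fz∈φ : InPhi Φ1 fz
    fz∈φ = φ₂-InPhi f z∈φ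
    ∂g-mono : ∂₂ g (φ₂ h′ fz) ℕ.≤ G
    ∂g-mono = ∂₂-mono g (φ₂-InPhi h′ fz∈φ) (φ₂-InPhi h fz∈φ) φh′≤φh

proposition2p32 :
    (P : Poly3) (α : Poly3.Π3 P) (F : Elementary P α) (I : PolyInterp (Poly3.P2 P)) →
    Compatible P (PolyInterp.fi I) α →
    Conservative P (PolyInterp.fi I) α →
    (x : Elt (Elementary.u F)) → InPhi (PolyInterp.Φ1 I) x →
    (ys : All (λ c → Σ (Elt (Poly2.s1 (Poly3.P2 P) c))
                       (PolyInterp.IsMaxBelow I c
                         (constE (PolyInterp.∂φ₂ I (Elementary.s2F F) x) (Poly2.s1 (Poly3.P2 P) c))))
              (cells (Poly3.P2 P) (Poly3.t2 P α))) →
    (+ PolyInterp.∂₂ I (Elementary.t2F F) x) - (+ PolyInterp.∂₂ I (Elementary.s2F F) x)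
      ≤ + PolyInterp.sumMax I ys
proposition2p32 P α F I compatible conservative x x∈φ ys =
  [+m]-[+n]≤+o _ _ _ (∂₂-replace-middle f (whisker a (s2 α) b) (whisker a (t2 α) b) g x∈φ
                        (φ₂-whisker-mono a (s2 α) (t2 α) b (compatible zα zα∈φ)) ∂-step)
  where
  open Poly3 P
  open Elementary F using (a; b; f; g; s2F)
  open PolyInterp I
  open Interp I
  z : Elt ((a ++₁ s1₃ α) ++₁ b)
  z = φ₂ f x
  zα : Elt (s1₃ α)
  zα = middle a (s1₃ α) z
  zα∈φ : InPhi Φ1 zα
  zα∈φ = InPhi-middle Φ1 a (s1₃ α) (φ₂-InPhi f x∈φ)
  ∂φ-t2α≤ : ∂φ₂ (t2 α) zα ℕ.≤ ∂φ₂ s2F x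
  ∂φ-t2α≤ = begin
    ∂φ₂ (t2 α) zα                ≤⟨ conservative zα zα∈φ ⟩
    ∂φ₂ (s2 α) zα                ≡⟨ ∂φ₂-whisker a (s2 α) b z ⟨
    ∂φ₂ (whisker a (s2 α) b) z   ≤⟨ ∂φ₂-middle≤ f (whisker a (s2 α) b) g x ⟩
    ∂φ₂ s2F x                    ∎
    where open ℕ.≤-Reasoning
  ∂-step : ∂₂ (whisker a (t2 α) b) z ℕ.≤ ∂₂ (whisker a (s2 α) b) z + sumMax ys
  ∂-step = begin
    ∂₂ (whisker a (t2 α) b) z               ≡⟨ ∂₂-whisker a (t2 α) b z ⟩
    ∂₂ (t2 α) zα                            ≤⟨ ∂₂≤sumMax (t2 α) zα∈φ ∂φ-t2α≤ ys ⟩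
    sumMax ys                               ≤⟨ ℕ.m≤n+m _ _ ⟩
    ∂₂ (whisker a (s2 α) b) z + sumMax ys   ∎
    where open ℕ.≤-Reasoning
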